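{- Let $k$ be an integer, $U$ a set, $X \subseteq U$, and $\mathcal{F}$ a $k$-wide family of subsets of $U$. Then there are at most $2^{|X|}$ sets $A \in \mathcal{F}$ with $|A \cup X| \le k$ and $|A| \le |X|$.
   Context: A family $\mathcal{F}$ of subsets of $U$ is $k$-wide if $|A\cup B|>k$ for any two distinct $A,B\in\mathcal{F}$. -}

module Defs where

open import Data.Nat using (ℕ)
open import Data.Integer using (ℤ; +_; _<_)
open import Data.Fin.Subset using (Subset; _∪_; ∣_∣)
open import Relation.Binary.PropositionalEquality using (_≢_)

Family : ℕ → Set₁
Family n = Subset n → Set

Wide : {n : ℕ} → ℤ → Family n → Set
Wide k 𝓕 = ∀ A B → 𝓕 A → 𝓕 B → A ≢ B → k < + ∣ A ∪ B ∣

-- Members of a k-wide family that are small in the sense of the statement are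
-- determined by their trace A ∩ X: if A ∩ X = B ∩ X then A ∩ X ⊆ A ∩ B, and
-- inclusion–exclusion with |B| ≤ |X| gives |A ∪ B| ≤ |A ∪ X| ≤ k, so A = B by
-- wideness. There are only 2^|X| traces.
module Submission where

open import Defs
open import Data.Nat using (ℕ; _≤_; _^_; suc; _+_)
open import Data.Nat.Properties using (+-suc; +-monoʳ-≤; +-cancelʳ-≤; module ≤-Reasoning)
open import Data.Integer using (ℤ; +_; +≤+) renaming (_≤_ to _≤ℤ_)
open import Data.Integer.Properties using (<-irrefl; <-≤-trans; ≤-trans)
open import Data.Bool using (Bool; true; false) renaming (_≟_ to _≟ᵇ_)
open import Data.Bool.Properties using (∧-zeroʳ; ∧-identityʳ)
open import Data.Fin using (Fin; zero; suc; combine)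
open import Data.Fin.Patterns using (0F; 1F)
open import Data.Fin.Properties using (combine-injective; injective⇒≤)
open import Data.Fin.Subset using (Subset; _∪_; _∩_; ∣_∣; _⊆_; inside; outside) renaming (_∈_ to _∈ₛ_)
open import Data.Fin.Subset.Properties using (p∩q⊆p; x∈p∩q⁺; p⊆q⇒∣p∣≤∣q∣)
open import Data.Vec using ([]; _∷_)
open import Data.Vec.Properties using (≡-dec)
open import Data.List using (List; length; lookup)
open import Data.List.Membership.Propositional using (_∈_)
open import Data.List.Membership.Propositional.Properties using (∈-lookup)
open import Data.List.Relation.Unary.All as All using ()
open import Data.List.Relation.Unary.Unique.Propositional using (Unique; _∷_)
open import Data.Product using (_×_; _,_)
open import Data.Empty using (⊥-elim)
open import Function using (_∘_)
open import Relation.Binary.PropositionalEquality using (_≡_; refl; sym; trans; cong; cong₂; subst)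
open import Relation.Nullary.Decidable using (decidable-stable)

∣p∪q∣+∣p∩q∣≡∣p∣+∣q∣ : ∀ {n} (p q : Subset n) → ∣ p ∪ q ∣ + ∣ p ∩ q ∣ ≡ ∣ p ∣ + ∣ q ∣
∣p∪q∣+∣p∩q∣≡∣p∣+∣q∣ []            []            = refl
∣p∪q∣+∣p∩q∣≡∣p∣+∣q∣ (inside  ∷ p) (inside  ∷ q) =
  cong suc (trans (+-suc ∣ p ∪ q ∣ ∣ p ∩ q ∣)
                  (trans (cong suc (∣p∪q∣+∣p∩q∣≡∣p∣+∣q∣ p q)) (sym (+-suc ∣ p ∣ ∣ q ∣))))
∣p∪q∣+∣p∩q∣≡∣p∣+∣q∣ (inside  ∷ p) (outside ∷ q) = cong suc (∣p∪q∣+∣p∩q∣≡∣p∣+∣q∣ p q)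
∣p∪q∣+∣p∩q∣≡∣p∣+∣q∣ (outside ∷ p) (inside  ∷ q) =
  trans (cong suc (∣p∪q∣+∣p∩q∣≡∣p∣+∣q∣ p q)) (sym (+-suc ∣ p ∣ ∣ q ∣))
∣p∪q∣+∣p∩q∣≡∣p∣+∣q∣ (outside ∷ p) (outside ∷ q) = ∣p∪q∣+∣p∩q∣≡∣p∣+∣q∣ p q

p∩r≡q∩r⇒p∩r⊆p∩q : ∀ {n} (p q r : Subset n) → p ∩ r ≡ q ∩ r → p ∩ r ⊆ p ∩ q
p∩r≡q∩r⇒p∩r⊆p∩q p q r eq x∈p∩r =
  x∈p∩q⁺ (p∩q⊆p p r x∈p∩r , p∩q⊆p q r (subst (_ ∈ₛ_) eq x∈p∩r))

∣p∪q∣≤∣p∪r∣ : ∀ {n} (p q r : Subset n) → p ∩ r ≡ q ∩ r → ∣ q ∣ ≤ ∣ r ∣ → ∣ p ∪ q ∣ ≤ ∣ p ∪ r ∣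
∣p∪q∣≤∣p∪r∣ p q r eq ∣q∣≤∣r∣ = +-cancelʳ-≤ ∣ p ∩ q ∣ _ _ (begin
  ∣ p ∪ q ∣ + ∣ p ∩ q ∣ ≡⟨ ∣p∪q∣+∣p∩q∣≡∣p∣+∣q∣ p q ⟩
  ∣ p ∣ + ∣ q ∣         ≤⟨ +-monoʳ-≤ ∣ p ∣ ∣q∣≤∣r∣ ⟩
  ∣ p ∣ + ∣ r ∣         ≡⟨ sym (∣p∪q∣+∣p∩q∣≡∣p∣+∣q∣ p r) ⟩
  ∣ p ∪ r ∣ + ∣ p ∩ r ∣ ≤⟨ +-monoʳ-≤ ∣ p ∪ r ∣ (p⊆q⇒∣p∣≤∣q∣ (p∩r≡q∩r⇒p∩r⊆p∩q p q r eq)) ⟩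
  ∣ p ∪ r ∣ + ∣ p ∩ q ∣ ∎)
  where open ≤-Reasoning

bit : Bool → Fin 2
bit false = 0F
bit true  = 1F

bit-injective : ∀ {a b} → bit a ≡ bit b → a ≡ b
bit-injective {false} {false} _ = refl
bit-injective {true}  {true}  _ = refl

-- The bits of A at the positions of X, read as a binary numeral.
traceCode : ∀ {n} (X : Subset n) → Subset n → Fin (2 ^ ∣ X ∣)
traceCode []            []      = 0F
traceCode (outside ∷ X) (_ ∷ A) = traceCode X A
traceCode (inside  ∷ X) (a ∷ A) = combine (bit a) (traceCode X A)

traceCode-injective : ∀ {n} (X A B : Subset n) → traceCode X A ≡ traceCode X B → A ∩ X ≡ B ∩ X
traceCode-injective []            []      []      _  = refl
traceCode-injective (outside ∷ X) (a ∷ A) (b ∷ B) eq =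
  cong₂ _∷_ (trans (∧-zeroʳ a) (sym (∧-zeroʳ b))) (traceCode-injective X A B eq)
traceCode-injective (inside  ∷ X) (a ∷ A) (b ∷ B) eq
  with bits≡ , codes≡ ← combine-injective (bit a) (traceCode X A) (bit b) (traceCode X B) eq =
  cong₂ _∷_ (trans (∧-identityʳ a) (trans (bit-injective bits≡) (sym (∧-identityʳ b))))
            (traceCode-injective X A B codes≡)

Unique⇒lookup-injective : ∀ {A : Set} {xs : List A} → Unique xs →
  ∀ i j → lookup xs i ≡ lookup xs j → i ≡ j
Unique⇒lookup-injective (_  ∷ _) zero    zero    _  = refl
Unique⇒lookup-injective (x∉ ∷ _) zero    (suc j) eq = ⊥-elim (All.lookup x∉ (∈-lookup j) eq)
Unique⇒lookup-injective (x∉ ∷ _) (suc i) zero    eq = ⊥-elim (All.lookup x∉ (∈-lookup i) (sym eq))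
Unique⇒lookup-injective (_  ∷ u) (suc i) (suc j) eq = cong suc (Unique⇒lookup-injective u i j eq)

Small : ∀ {n} → ℤ → Subset n → Family n → Subset n → Set
Small k X 𝓕 A = 𝓕 A × (+ ∣ A ∪ X ∣ ≤ℤ k) × (∣ A ∣ ≤ ∣ X ∣)

wide⇒small-trace-injective : ∀ {n} {k : ℤ} {X : Subset n} {𝓕 : Family n} → Wide k 𝓕 →
  ∀ {A B} → Small k X 𝓕 A → Small k X 𝓕 B → A ∩ X ≡ B ∩ X → A ≡ B
wide⇒small-trace-injective {X = X} wide {A} {B} (𝓕A , ∣A∪X∣≤k , _) (𝓕B , _ , ∣B∣≤∣X∣) eq =
  decidable-stable (≡-dec _≟ᵇ_ A B) λ A≢B →
    <-irrefl refl (<-≤-trans (wide A B 𝓕A 𝓕B A≢B) (≤-trans (+≤+ (∣p∪q∣≤∣p∪r∣ A B X eq ∣B∣≤∣X∣)) ∣A∪X∣≤k))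

lemma5p1 : (n : ℕ) (k : ℤ) (X : Subset n) (𝓕 : Family n) → Wide k 𝓕 →
    (G : List (Subset n)) → Unique G →
    (∀ A → A ∈ G → 𝓕 A × (+ ∣ A ∪ X ∣ ≤ℤ k) × (∣ A ∣ ≤ ∣ X ∣)) →
    length G ≤ 2 ^ ∣ X ∣
lemma5p1 n k X 𝓕 wide G unique small = injective⇒≤ {f = traceCode X ∘ lookup G} codeInjective
  where
  codeInjective : ∀ {i j} → traceCode X (lookup G i) ≡ traceCode X (lookup G j) → i ≡ j
  codeInjective {i} {j} eq =
    Unique⇒lookup-injective unique i j
      (wide⇒small-trace-injective wide (small _ (∈-lookup i)) (small _ (∈-lookup j))
        (traceCode-injective X _ _ eq))
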